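{- Let $a,b,c,d$ be real numbers with $a+b=c+d$, let $n\ge 1$, and let $k_1,\dots,k_n$ be arbitrary real numbers. Define finite sequences $x^{(m)}=(x^{(m)}_1,\dots,x^{(m)}_{2^m})$ and $y^{(m)}=(y^{(m)}_1,\dots,y^{(m)}_{2^m})$ for $1\le m\le n$ recursively by $x^{(1)}=(a+k_1,\;b+k_1)$, $y^{(1)}=(c+k_1,\;d+k_1)$, and for $2\le m\le n$ and $1\le j\le 2^{m-1}$: $x^{(m)}_j=x^{(m-1)}_j$, $x^{(m)}_{2^{m-1}+j}=y^{(m-1)}_j+k_m$, $y^{(m)}_j=y^{(m-1)}_j$, $y^{(m)}_{2^{m-1}+j}=x^{(m-1)}_j+k_m$. Write $x_i=x^{(n)}_i$ and $y_i=y^{(n)}_i$ for $1\le i\le 2^n$. Then for every $p$ with $1\le p\le n$: (i) $\displaystyle\sum_{i=1}^{2^n}x_i^p=\sum_{i=1}^{2^n}y_i^p$, and (ii) $\displaystyle\sum_{i=1}^{2^p}x_i^p=\sum_{i=1}^{2^p}y_i^p$.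
   Context: All numbers are real. Note that by construction the first $2^m$ entries of $x^{(n)}$ (resp. $y^{(n)}$) coincide with $x^{(m)}$ (resp. $y^{(m)}$) for $m\le n$. -}

module Defs where

open import Level using (0ℓ)
open import Algebra.Bundles using (CommutativeRing)
open import Relation.Binary.Structures using (IsStrictTotalOrder)
open import Relation.Nullary using (¬_)
open import Data.Product using (Σ; _×_; _,_; proj₁; proj₂)
open import Data.Sum using (_⊎_)
open import Data.Nat as ℕ using (ℕ; zero; suc; _<ᵇ_; _∸_)
open import Data.Bool using (if_then_else_)
open import Data.Fin using (Fin; inject₁; fromℕ)
open import Function using (_∘_)

record RealNumbers : Set₁ where
  field
    commRing : CommutativeRing 0ℓ 0ℓ
  open CommutativeRing commRing public
  field
    _<_              : Carrier → Carrier → Set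
    <-isStrictTotal  : IsStrictTotalOrder _≈_ _<_
    nontrivial       : ¬ (0# ≈ 1#)
    inverse          : ∀ x → ¬ (x ≈ 0#) → Σ Carrier λ y → (x * y) ≈ 1#
    +-mono-<         : ∀ {x y} z → x < y → (x + z) < (y + z)
    *-pos            : ∀ {x y} → 0# < x → 0# < y → 0# < (x * y)
    -- least upper bound property (≤ written as  < ⊎ ≈)
    complete         : (S : Carrier → Set) → Σ Carrier S →
                       Σ Carrier (λ u → ∀ s → S s → (s < u) ⊎ (s ≈ u)) →
                       Σ Carrier λ sup →
                         (∀ s → S s → (s < sup) ⊎ (s ≈ sup)) ×
                         (∀ u → (∀ s → S s → (s < u) ⊎ (s ≈ u)) →
                                (sup < u) ⊎ (sup ≈ u))

module _ (R : RealNumbers) where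
  open RealNumbers R

  pow : Carrier → ℕ → Carrier
  pow x zero    = 1#
  pow x (suc p) = x * pow x p

  -- sumTo m f = f 0 + f 1 + ... + f (m-1)   (0-based indices)
  sumTo : ℕ → (ℕ → Carrier) → Carrier
  sumTo zero    f = 0#
  sumTo (suc m) f = sumTo m f + f m

  -- seqs a b c d n k = (x^(n+1), y^(n+1)) as 0-based sequences ℕ → ℝ
  -- (only indices < 2^(n+1) are meaningful), where k i = k_{i+1}.
  seqs : (a b c d : Carrier) (n : ℕ) → (Fin (suc n) → Carrier) →
         (ℕ → Carrier) × (ℕ → Carrier)
  seqs a b c d zero k =
    (λ i → if i <ᵇ 1 then a + k Fin.zero else b + k Fin.zero) ,
    (λ i → if i <ᵇ 1 then c + k Fin.zero else d + k Fin.zero)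
    where import Data.Fin as Fin
  seqs a b c d (suc n) k =
    (λ i → if i <ᵇ h then x i else y (i ∸ h) + km) ,
    (λ i → if i <ᵇ h then y i else x (i ∸ h) + km)
    where
      prev = seqs a b c d n (k ∘ inject₁)
      x = proj₁ prev
      y = proj₂ prev
      km = k (fromℕ (suc n))
      h = 2 ℕ.^ suc n

{-# OPTIONS --safe #-}
-- Call f of degree ≤ d when all its (d+1)-fold finite differences
-- Δ_h f x = f x − f (x + h) vanish; every power x ↦ x^p has degree ≤ p.
-- By induction on n, Σ f(x_i) = Σ f(y_i) for every f of degree ≤ n.
-- For n = 1 this is additivity of affine maps together with a + b = c + d.
-- At level n + 1 the sums split into halves, giving Σ f(x) + Σ f(y + k)
-- against Σ f(y) + Σ f(x + k); their difference is Σ Δ_k f(x) − Σ Δ_k f(y),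
-- which vanishes by the induction hypothesis since Δ_k f has degree ≤ n.
-- Part (ii) follows because the first 2^p entries of x^(n) are x^(p).
module Submission where

open import Defs
open import Data.Nat using (ℕ; suc; _≤_; _^_)
open import Data.Fin using (Fin)
open import Data.Product using (_×_; proj₁; proj₂)

open import Level using (Level)
open import Algebra.Bundles using (CommutativeRing)
import Algebra.Properties.AbelianGroup as AbelianGroupProperties
import Algebra.Properties.CommutativeSemigroup as CommutativeSemigroupProperties
import Algebra.Properties.Ring as RingProperties
import Data.Nat as ℕ
open import Data.Nat using (zero; _<_; _<ᵇ_; _≤′_; ≤′-refl; ≤′-step; s≤s; z≤n)
import Data.Nat.Properties as ℕₚ
open import Data.Nat.Properties using (m+n∸m≡n; <⇒<ᵇ; n<1+n; m<n⇒m<1+n; <-≤-trans; ^-monoʳ-≤; ≤′⇒≤; ≤⇒≤′)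
open import Data.Bool using (true; false)
open import Data.Fin using (inject₁; fromℕ)
open import Data.Product using (∃; _,_; zip′)
open import Function using (_∘_)
open import Relation.Binary.Core using (_Preserves_⟶_)
open import Relation.Binary.PropositionalEquality as ≡ using (_≡_)

module FiniteDifferences {c ℓ : Level} (CR : CommutativeRing c ℓ) where
  open CommutativeRing CR
  open AbelianGroupProperties +-abelianGroup using (⁻¹-∙-comm; //-rightDividesˡ; x≈y⇒x∙y⁻¹≈ε)
  open CommutativeSemigroupProperties +-commutativeSemigroup using (interchange; xy∙z≈xz∙y)
  open RingProperties ring using (-‿distribˡ-*; x[y-z]≈xy-xz)
  open import Relation.Binary.Reasoning.Setoid setoid

  [a+b]-[c+d]≈[a-c]+[b-d] : ∀ a b c d → (a + b) - (c + d) ≈ (a - c) + (b - d)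
  [a+b]-[c+d]≈[a-c]+[b-d] a b c d =
    trans (+-congˡ (sym (⁻¹-∙-comm c d))) (interchange a b (- c) (- d))

  a-b≈c-d⇒a+d≈c+b : ∀ {a b c d} → a - b ≈ c - d → a + d ≈ c + b
  a-b≈c-d⇒a+d≈c+b {a} {b} {c} {d} a-b≈c-d = begin
    a + d                ≈⟨ +-congʳ (//-rightDividesˡ b a) ⟨
    ((a - b) + b) + d    ≈⟨ xy∙z≈xz∙y (a - b) b d ⟩
    ((a - b) + d) + b    ≈⟨ +-congʳ (+-congʳ a-b≈c-d) ⟩
    ((c - d) + d) + b    ≈⟨ +-congʳ (//-rightDividesˡ d c) ⟩
    c + b                ∎

  Δ : Carrier → (Carrier → Carrier) → Carrier → Carrier
  Δ h f x = f x - f (x + h)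

  Δ-cong : ∀ h {f} → f Preserves _≈_ ⟶ _≈_ → Δ h f Preserves _≈_ ⟶ _≈_
  Δ-cong h f-cong x≈y = +-cong (f-cong x≈y) (-‿cong (f-cong (+-congʳ x≈y)))

  Δ-x*f : ∀ h f x → Δ h (λ y → y * f y) x ≈ x * Δ h f x + - h * f (x + h)
  Δ-x*f h f x = begin
    x * f x - (x + h) * f (x + h)
      ≈⟨ +-congˡ (-‿cong (distribʳ _ x h)) ⟩
    x * f x - (x * f (x + h) + h * f (x + h))
      ≈⟨ +-congˡ (⁻¹-∙-comm _ _) ⟨
    x * f x + (- (x * f (x + h)) + - (h * f (x + h)))
      ≈⟨ +-assoc _ _ _ ⟨
    (x * f x - x * f (x + h)) + - (h * f (x + h))
      ≈⟨ +-cong (x[y-z]≈xy-xz x _ _) (sym (-‿distribˡ-* h _)) ⟨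
    x * Δ h f x + - h * f (x + h)
      ∎

  Degree≤ : ℕ → (Carrier → Carrier) → Set (c Level.⊔ ℓ)
  Degree≤ zero    f = ∀ x y → f x ≈ f y
  Degree≤ (suc d) f = ∀ h → Degree≤ d (Δ h f)

  Degree≤0⇒Δ≈0 : ∀ {f} → Degree≤ 0 f → ∀ h x → Δ h f x ≈ 0#
  Degree≤0⇒Δ≈0 f-const h x = x≈y⇒x∙y⁻¹≈ε (f-const x (x + h))

  Degree≤-resp : ∀ d {f g} → (∀ x → f x ≈ g x) → Degree≤ d f → Degree≤ d g
  Degree≤-resp zero    f≈g deg x y = trans (sym (f≈g x)) (trans (deg x y) (f≈g y))
  Degree≤-resp (suc d) f≈g deg h =
    Degree≤-resp d (λ x → +-cong (f≈g x) (-‿cong (f≈g (x + h)))) (deg h)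

  Degree≤-suc : ∀ d {f} → Degree≤ d f → Degree≤ (suc d) f
  Degree≤-suc zero    deg h x y = +-cong (deg x y) (-‿cong (deg (x + h) (y + h)))
  Degree≤-suc (suc d) deg h     = Degree≤-suc d (deg h)

  Degree≤-mono : ∀ {d e f} → d ≤ e → Degree≤ d f → Degree≤ e f
  Degree≤-mono {e = zero}  z≤n       deg   = deg
  Degree≤-mono {e = suc e} z≤n       deg   = Degree≤-suc e (Degree≤-mono z≤n deg)
  Degree≤-mono             (s≤s d≤e) deg h = Degree≤-mono d≤e (deg h)

  Degree≤-+ : ∀ d {f g} → Degree≤ d f → Degree≤ d g → Degree≤ d (λ x → f x + g x)
  Degree≤-+ zero    deg-f deg-g x y = +-cong (deg-f x y) (deg-g x y)
  Degree≤-+ (suc d) deg-f deg-g h   = Degree≤-resp d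
    (λ x → sym ([a+b]-[c+d]≈[a-c]+[b-d] _ _ _ _)) (Degree≤-+ d (deg-f h) (deg-g h))

  Degree≤-scale : ∀ d a {f} → Degree≤ d f → Degree≤ d (λ x → a * f x)
  Degree≤-scale zero    a deg x y = *-congˡ (deg x y)
  Degree≤-scale (suc d) a deg h   =
    Degree≤-resp d (λ x → x[y-z]≈xy-xz a _ _) (Degree≤-scale d a (deg h))

  Degree≤-shift : ∀ d a {f} → f Preserves _≈_ ⟶ _≈_ → Degree≤ d f → Degree≤ d (λ x → f (x + a))
  Degree≤-shift zero    a f-cong deg x y = deg (x + a) (y + a)
  Degree≤-shift (suc d) a f-cong deg h   = Degree≤-resp d
    (λ x → +-congˡ (-‿cong (f-cong (xy∙z≈xz∙y x a h))))
    (Degree≤-shift d a (Δ-cong h f-cong) (deg h))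

  Degree≤-x*f : ∀ d {f} → f Preserves _≈_ ⟶ _≈_ → Degree≤ d f → Degree≤ (suc d) (λ x → x * f x)
  Degree≤-x*f zero {f} f-cong deg h x y = begin
    Δ h (λ z → z * f z) x          ≈⟨ Δ-x*f h f x ⟩
    x * Δ h f x + - h * f (x + h)  ≈⟨ +-cong (x*Δ≈0 x) (*-congˡ (deg (x + h) (y + h))) ⟩
    0# + - h * f (y + h)           ≈⟨ +-congʳ (x*Δ≈0 y) ⟨
    y * Δ h f y + - h * f (y + h)  ≈⟨ Δ-x*f h f y ⟨
    Δ h (λ z → z * f z) y          ∎
    where
    x*Δ≈0 : ∀ x → x * Δ h f x ≈ 0#
    x*Δ≈0 x = trans (*-congˡ (Degree≤0⇒Δ≈0 deg h x)) (zeroʳ x)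
  Degree≤-x*f (suc d) {f} f-cong deg h = Degree≤-resp (suc d) (λ x → sym (Δ-x*f h f x))
    (Degree≤-+ (suc d) (Degree≤-x*f d (Δ-cong h f-cong) (deg h))
                       (Degree≤-scale (suc d) (- h) (Degree≤-shift (suc d) h f-cong deg)))

  Degree≤1⇒additive : ∀ {f} → f Preserves _≈_ ⟶ _≈_ → Degree≤ 1 f →
                      ∀ u v → f u + f v ≈ f (u + v) + f 0#
  Degree≤1⇒additive {f} f-cong deg u v = begin
    f u + f v          ≈⟨ +-congˡ (f-cong (+-identityˡ v)) ⟨
    f u + f (0# + v)   ≈⟨ a-b≈c-d⇒a+d≈c+b (deg v u 0#) ⟩
    f 0# + f (u + v)   ≈⟨ +-comm _ _ ⟩
    f (u + v) + f 0#   ∎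

  Degree≤1⇒sum-invariant : ∀ {f} → f Preserves _≈_ ⟶ _≈_ → Degree≤ 1 f →
                           ∀ {u v u′ v′} → u + v ≈ u′ + v′ → f u + f v ≈ f u′ + f v′
  Degree≤1⇒sum-invariant {f} f-cong deg {u} {v} {u′} {v′} u+v≈u′+v′ = begin
    f u + f v                ≈⟨ Degree≤1⇒additive f-cong deg u v ⟩
    f (u + v) + f 0#         ≈⟨ +-congʳ (f-cong u+v≈u′+v′) ⟩
    f (u′ + v′) + f 0#       ≈⟨ Degree≤1⇒additive f-cong deg u′ v′ ⟨
    f u′ + f v′              ∎

module PowerSums (R : RealNumbers) where
  open RealNumbers R hiding (_<_)
  open FiniteDifferences commRing
  open CommutativeSemigroupProperties +-commutativeSemigroup using (interchange)
  open import Relation.Binary.Reasoning.Setoid setoid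

  pow-cong : ∀ p → (λ x → pow R x p) Preserves _≈_ ⟶ _≈_
  pow-cong zero    x≈y = refl
  pow-cong (suc p) x≈y = *-cong x≈y (pow-cong p x≈y)

  Degree≤-pow : ∀ p → Degree≤ p (λ x → pow R x p)
  Degree≤-pow zero    x y = refl
  Degree≤-pow (suc p) = Degree≤-x*f p (pow-cong p) (Degree≤-pow p)

  sumTo-cong : ∀ m {f g} → (∀ i → i < m → f i ≈ g i) → sumTo R m f ≈ sumTo R m g
  sumTo-cong zero    f≈g = refl
  sumTo-cong (suc m) f≈g =
    +-cong (sumTo-cong m (λ i i<m → f≈g i (m<n⇒m<1+n i<m))) (f≈g m (n<1+n m))

  sumTo-+ : ∀ m n f → sumTo R (m ℕ.+ n) f ≈ sumTo R m f + sumTo R n (λ i → f (m ℕ.+ i))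
  sumTo-+ m zero    f rewrite ℕₚ.+-identityʳ m = sym (+-identityʳ _)
  sumTo-+ m (suc n) f rewrite ℕₚ.+-suc m n =
    trans (+-congʳ (sumTo-+ m n f)) (+-assoc _ _ _)

  sumTo-double : ∀ m f → sumTo R (2 ℕ.* m) f ≈ sumTo R m f + sumTo R m (λ i → f (m ℕ.+ i))
  sumTo-double m f rewrite ℕₚ.+-identityʳ m = sumTo-+ m m f

  sumTo-distrib-sub : ∀ m f g → sumTo R m (λ i → f i - g i) ≈ sumTo R m f - sumTo R m g
  sumTo-distrib-sub zero    f g = sym (-‿inverseʳ 0#)
  sumTo-distrib-sub (suc m) f g =
    trans (+-congʳ (sumTo-distrib-sub m f g)) (sym ([a+b]-[c+d]≈[a-c]+[b-d] _ _ _ _))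

  m+n<ᵇm≡false : ∀ m n → ((m ℕ.+ n) <ᵇ m) ≡ false
  m+n<ᵇm≡false zero    n = ≡.refl
  m+n<ᵇm≡false (suc m) n = m+n<ᵇm≡false m n

  module Sequences (a b c d : Carrier) (a+b≈c+d : a + b ≈ c + d) where

    X Y : ∀ n → (Fin (suc n) → Carrier) → ℕ → Carrier
    X n k = proj₁ (seqs R a b c d n k)
    Y n k = proj₂ (seqs R a b c d n k)

    seqs-lower : ∀ n k i → i < 2 ^ suc n →
                 X (suc n) k i ≡ X n (k ∘ inject₁) i × Y (suc n) k i ≡ Y n (k ∘ inject₁) i
    seqs-lower n k i i<2^n with i <ᵇ 2 ^ suc n | <⇒<ᵇ i<2^n
    ... | true | _ = ≡.refl , ≡.refl

    seqs-upper : ∀ n k i → let h = 2 ^ suc n; k′ = k ∘ inject₁; kₙ = k (fromℕ (suc n)) in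
                 X (suc n) k (h ℕ.+ i) ≡ Y n k′ i + kₙ × Y (suc n) k (h ℕ.+ i) ≡ X n k′ i + kₙ
    seqs-upper n k i rewrite m+n<ᵇm≡false (2 ^ suc n) i | m+n∸m≡n (2 ^ suc n) i =
      ≡.refl , ≡.refl

    seqs-prefix : ∀ {m n} → m ≤′ n → ∀ k → ∃ λ k′ → ∀ i → i < 2 ^ suc m →
                  X n k i ≡ X m k′ i × Y n k i ≡ Y m k′ i
    seqs-prefix ≤′-refl k = k , λ _ _ → ≡.refl , ≡.refl
    seqs-prefix {m} {suc n} (≤′-step m≤′n) k with seqs-prefix m≤′n (k ∘ inject₁)
    ... | k′ , agree = k′ , λ i i<2^m →
      zip′ ≡.trans ≡.trans
        (seqs-lower n k i (<-≤-trans i<2^m (^-monoʳ-≤ 2 (s≤s (≤′⇒≤ m≤′n)))))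
        (agree i i<2^m)

    sums-agree : ∀ n k {f} → f Preserves _≈_ ⟶ _≈_ → Degree≤ (suc n) f →
                 sumTo R (2 ^ suc n) (f ∘ X n k) ≈ sumTo R (2 ^ suc n) (f ∘ Y n k)
    sums-agree zero k {f} f-cong deg = begin
      0# + f (a + k₀) + f (b + k₀)    ≈⟨ +-assoc _ _ _ ⟩
      0# + (f (a + k₀) + f (b + k₀))
        ≈⟨ +-congˡ (Degree≤1⇒sum-invariant f-cong deg [a+k]+[b+k]≈[c+k]+[d+k]) ⟩
      0# + (f (c + k₀) + f (d + k₀))  ≈⟨ +-assoc _ _ _ ⟨
      0# + f (c + k₀) + f (d + k₀)    ∎
      where
      k₀ = k (fromℕ 0)
      [a+k]+[b+k]≈[c+k]+[d+k] : (a + k₀) + (b + k₀) ≈ (c + k₀) + (d + k₀)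
      [a+k]+[b+k]≈[c+k]+[d+k] = begin
        (a + k₀) + (b + k₀)  ≈⟨ interchange a k₀ b k₀ ⟩
        (a + b) + (k₀ + k₀)  ≈⟨ +-congʳ a+b≈c+d ⟩
        (c + d) + (k₀ + k₀)  ≈⟨ interchange c d k₀ k₀ ⟩
        (c + k₀) + (d + k₀)  ∎
    sums-agree (suc n) k {f} f-cong deg = begin
      sumTo R (2 ℕ.* h) (f ∘ X (suc n) k)  ≈⟨ sumTo-double h _ ⟩
      sumTo R h (f ∘ X (suc n) k) + sumTo R h (λ i → f (X (suc n) k (h ℕ.+ i)))
        ≈⟨ +-cong (sumTo-cong h (λ i i<h → f-cong (reflexive (proj₁ (seqs-lower n k i i<h)))))
                  (sumTo-cong h (λ i _ → f-cong (reflexive (proj₁ (seqs-upper n k i))))) ⟩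
      Σ x + Σ (λ i → y i + kₙ)
        ≈⟨ a-b≈c-d⇒a+d≈c+b (begin
             Σ x - Σ (λ i → x i + kₙ)          ≈⟨ sumTo-distrib-sub h _ _ ⟨
             sumTo R h (Δ kₙ f ∘ x)            ≈⟨ sums-agree n k′ (Δ-cong kₙ f-cong) (deg kₙ) ⟩
             sumTo R h (Δ kₙ f ∘ y)            ≈⟨ sumTo-distrib-sub h _ _ ⟩
             Σ y - Σ (λ i → y i + kₙ)          ∎) ⟩
      Σ y + Σ (λ i → x i + kₙ)
        ≈⟨ +-cong (sumTo-cong h (λ i i<h → f-cong (reflexive (proj₂ (seqs-lower n k i i<h)))))
                  (sumTo-cong h (λ i _ → f-cong (reflexive (proj₂ (seqs-upper n k i))))) ⟨
      sumTo R h (f ∘ Y (suc n) k) + sumTo R h (λ i → f (Y (suc n) k (h ℕ.+ i)))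
        ≈⟨ sumTo-double h _ ⟨
      sumTo R (2 ℕ.* h) (f ∘ Y (suc n) k)  ∎
      where
      h = 2 ^ suc n
      k′ = k ∘ inject₁
      kₙ = k (fromℕ (suc n))
      x = X n k′
      y = Y n k′
      Σ : (ℕ → Carrier) → Carrier
      Σ z = sumTo R h (f ∘ z)

    prefix-sums-agree : ∀ {m n} → m ≤ n → ∀ k {f} → f Preserves _≈_ ⟶ _≈_ →
                        Degree≤ (suc m) f →
                        sumTo R (2 ^ suc m) (f ∘ X n k) ≈ sumTo R (2 ^ suc m) (f ∘ Y n k)
    prefix-sums-agree {m} {n} m≤n k {f} f-cong deg with seqs-prefix (≤⇒≤′ m≤n) k
    ... | k′ , agree = begin
      sumTo R (2 ^ suc m) (f ∘ X n k)
        ≈⟨ sumTo-cong _ (λ i i<2^m → f-cong (reflexive (proj₁ (agree i i<2^m)))) ⟩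
      sumTo R (2 ^ suc m) (f ∘ X m k′)
        ≈⟨ sums-agree m k′ f-cong deg ⟩
      sumTo R (2 ^ suc m) (f ∘ Y m k′)
        ≈⟨ sumTo-cong _ (λ i i<2^m → f-cong (reflexive (proj₂ (agree i i<2^m)))) ⟨
      sumTo R (2 ^ suc m) (f ∘ Y n k)
        ∎

theorem2 : (R : RealNumbers) → (a b c d : RealNumbers.Carrier R) →
           RealNumbers._≈_ R (RealNumbers._+_ R a b) (RealNumbers._+_ R c d) →
           (n' : ℕ) → (k : Fin (suc n') → RealNumbers.Carrier R) →
           (p : ℕ) → 1 ≤ p → p ≤ suc n' →
           (RealNumbers._≈_ R
              (sumTo R (2 ^ suc n') (λ i → pow R (proj₁ (seqs R a b c d n' k) i) p))
              (sumTo R (2 ^ suc n') (λ i → pow R (proj₂ (seqs R a b c d n' k) i) p)))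
           ×
           (RealNumbers._≈_ R
              (sumTo R (2 ^ p) (λ i → pow R (proj₁ (seqs R a b c d n' k) i) p))
              (sumTo R (2 ^ p) (λ i → pow R (proj₂ (seqs R a b c d n' k) i) p)))
theorem2 R a b c d a+b≈c+d n k (suc p) (s≤s z≤n) (s≤s p≤n) =
  sums-agree n k (pow-cong (suc p)) (Degree≤-mono (s≤s p≤n) (Degree≤-pow (suc p))) ,
  prefix-sums-agree p≤n k (pow-cong (suc p)) (Degree≤-pow (suc p))
  where
  open PowerSums R using (pow-cong; Degree≤-pow)
  open PowerSums.Sequences R a b c d a+b≈c+d using (sums-agree; prefix-sums-agree)
  open FiniteDifferences (RealNumbers.commRing R) using (Degree≤-mono)
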